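{- In System $\mathsf{F}_\wedge$, if $\Theta,X<:S\vdash T<:T'$ then $\Theta\vdash\forall X.T[X\wedge S/X]<:\forall X.T'[X\wedge S/X]$.
   Context: System $\mathsf{F}_\wedge$. Types: $T ::= \top\mid X\mid T\to T\mid\forall X.T\mid T\wedge T$ (up to $\alpha$-conversion). Contexts $\Theta$ are finite sequences of assumptions $X<:T$ and $x:T$ ($T$ any $\mathsf{F}_\wedge$-type), with the usual well-formedness judgment $\Theta\vdash T$ ($\Theta\vdash\forall X.T$ from $\Theta,X<:\top\vdash T$; $\Theta\vdash S\wedge T$ from $\Theta\vdash S,T$). Subtyping $\Theta\vdash S<:T$ is generated by: (Var) $\Theta,X<:T,\Theta'\vdash X<:T$; (Top) $\Theta\vdash T<:\top$; (Refl); (Trans); ($\to$) from $\Theta\vdash S'<:S$, $\Theta\vdash T<:T'$ infer $\Theta\vdash S\to T<:S'\to T'$; ($\forall$) from $\Theta,X<:\top\vdash S<:T$ infer $\Theta\vdash\forall X.S<:\forall X.T$; $\Theta\vdash S\wedge S'<:S$; $\Theta\vdash S\wedge S'<:S'$; from $\Theta\vdash T<:S$ and $\Theta\vdash T<:S'$ infer $\Theta\vdash T<:S\wedge S'$. $T[R/X]$ is capture-avoiding substitution. -}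

module Defs where

open import Data.Nat using (ℕ; zero; suc)
open import Data.Fin using (Fin; zero; suc)

-- Types of System F∧, well-scoped de Bruijn representation:
-- Ty n = types whose free type variables are among n variables
-- (index 0 = most recently bound). α-conversion is built in.
data Ty (n : ℕ) : Set where
  ⊤′  : Ty n
  var : Fin n → Ty n
  _⇒_ : Ty n → Ty n → Ty n
  ∀′  : Ty (suc n) → Ty n
  _∧_ : Ty n → Ty n → Ty n

infixr 7 _⇒_
infixl 8 _∧_

ext : ∀ {m n} → (Fin m → Fin n) → Fin (suc m) → Fin (suc n)
ext ρ zero    = zero
ext ρ (suc i) = suc (ρ i)

rename : ∀ {m n} → (Fin m → Fin n) → Ty m → Ty n
rename ρ ⊤′      = ⊤′
rename ρ (var i) = var (ρ i)
rename ρ (A ⇒ B) = rename ρ A ⇒ rename ρ B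
rename ρ (∀′ A)  = ∀′ (rename (ext ρ) A)
rename ρ (A ∧ B) = rename ρ A ∧ rename ρ B

weaken : ∀ {n} → Ty n → Ty (suc n)
weaken = rename suc

exts : ∀ {m n} → (Fin m → Ty n) → Fin (suc m) → Ty (suc n)
exts σ zero    = var zero
exts σ (suc i) = weaken (σ i)

subst : ∀ {m n} → (Fin m → Ty n) → Ty m → Ty n
subst σ ⊤′      = ⊤′
subst σ (var i) = σ i
subst σ (A ⇒ B) = subst σ A ⇒ subst σ B
subst σ (∀′ A)  = ∀′ (subst (exts σ) A)
subst σ (A ∧ B) = subst σ A ∧ subst σ B

-- T[R/X] where X is the innermost variable (index 0) and R may mention X
-- (single-variable substitution leaving all other variables fixed).
substTop : ∀ {n} → Ty (suc n) → Ty (suc n) → Ty (suc n)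
substTop {n} R T = subst σ T
  where
  σ : Fin (suc n) → Ty (suc n)
  σ zero    = R
  σ (suc i) = var (suc i)

-- T[X ∧ S / X], where S lives in the outer context Θ
substMeetBound : ∀ {n} → Ty n → Ty (suc n) → Ty (suc n)
substMeetBound S T = substTop (var zero ∧ weaken S) T

-- Contexts: sequences of X <: T (binds a type variable) and x : T
-- (term assumption, binds no type variable).
data Ctx : ℕ → Set where
  ε     : Ctx zero
  _,<:_ : ∀ {n} → Ctx n → Ty n → Ctx (suc n)
  _,∶_  : ∀ {n} → Ctx n → Ty n → Ctx n

infixl 5 _,<:_ _,∶_

-- Θ ∋ X <: T : the assumption X <: T occurs in Θ (T weakened to Θ's scope)
data _∋_<:_ : ∀ {n} → Ctx n → Fin n → Ty n → Set where
  here  : ∀ {n} {Θ : Ctx n} {T : Ty n} → (Θ ,<: T) ∋ zero <: weaken T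
  there : ∀ {n} {Θ : Ctx n} {X : Fin n} {T S : Ty n} →
          Θ ∋ X <: T → (Θ ,<: S) ∋ suc X <: weaken T
  skip  : ∀ {n} {Θ : Ctx n} {X : Fin n} {T S : Ty n} →
          Θ ∋ X <: T → (Θ ,∶ S) ∋ X <: T

infix 4 _⊢_<:_ _∋_<:_

data _⊢_<:_ : ∀ {n} → Ctx n → Ty n → Ty n → Set where
  S-Var   : ∀ {n} {Θ : Ctx n} {X T} → Θ ∋ X <: T → Θ ⊢ var X <: T
  S-Top   : ∀ {n} {Θ : Ctx n} {T} → Θ ⊢ T <: ⊤′
  S-Refl  : ∀ {n} {Θ : Ctx n} {T} → Θ ⊢ T <: T
  S-Trans : ∀ {n} {Θ : Ctx n} {S T U} → Θ ⊢ S <: T → Θ ⊢ T <: U → Θ ⊢ S <: U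
  S-Arrow : ∀ {n} {Θ : Ctx n} {S S′ T T′} →
            Θ ⊢ S′ <: S → Θ ⊢ T <: T′ → Θ ⊢ S ⇒ T <: S′ ⇒ T′
  S-All   : ∀ {n} {Θ : Ctx n} {S T} →
            (Θ ,<: ⊤′) ⊢ S <: T → Θ ⊢ ∀′ S <: ∀′ T
  S-MeetL : ∀ {n} {Θ : Ctx n} {S S′} → Θ ⊢ S ∧ S′ <: S
  S-MeetR : ∀ {n} {Θ : Ctx n} {S S′} → Θ ⊢ S ∧ S′ <: S′
  S-Meet  : ∀ {n} {Θ : Ctx n} {T S S′} →
            Θ ⊢ T <: S → Θ ⊢ T <: S′ → Θ ⊢ T <: S ∧ S′

-- The substitution X ↦ X ∧ S sends every type variable to a subtype of (the image of)
-- its bound, since X ∧ S <: S; so it turns a derivation under X <: S into one under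
-- X <: ⊤. This is an instance of the substitution lemma for subtyping, which holds
-- for every substitution respecting bounds and is proved by induction on derivations.
module Submission where

open import Data.Nat using (suc)
open import Data.Fin using (Fin; zero; suc)
open import Relation.Binary.PropositionalEquality using (_≡_; refl; cong; cong₂; sym; trans)
open import Defs

rename-commute : ∀ {a b c d} (ρ : Fin b → Fin d) (τ : Fin a → Fin b)
  (ρ′ : Fin c → Fin d) (τ′ : Fin a → Fin c) →
  (∀ i → ρ (τ i) ≡ ρ′ (τ′ i)) → ∀ A → rename ρ (rename τ A) ≡ rename ρ′ (rename τ′ A)
rename-commute ρ τ ρ′ τ′ h ⊤′      = refl
rename-commute ρ τ ρ′ τ′ h (var i) = cong var (h i)
rename-commute ρ τ ρ′ τ′ h (A ⇒ B) =
  cong₂ _⇒_ (rename-commute ρ τ ρ′ τ′ h A) (rename-commute ρ τ ρ′ τ′ h B)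
rename-commute ρ τ ρ′ τ′ h (A ∧ B) =
  cong₂ _∧_ (rename-commute ρ τ ρ′ τ′ h A) (rename-commute ρ τ ρ′ τ′ h B)
rename-commute ρ τ ρ′ τ′ h (∀′ A)  =
  cong ∀′ (rename-commute (ext ρ) (ext τ) (ext ρ′) (ext τ′) h′ A)
  where
  h′ : ∀ i → ext ρ (ext τ i) ≡ ext ρ′ (ext τ′ i)
  h′ zero    = refl
  h′ (suc i) = cong suc (h i)

rename-weaken : ∀ {m n} (ρ : Fin m → Fin n) A → rename (ext ρ) (weaken A) ≡ weaken (rename ρ A)
rename-weaken ρ = rename-commute (ext ρ) suc suc ρ (λ _ → refl)

subst-rename : ∀ {a b c} (σ : Fin b → Ty c) (ρ : Fin a → Fin b) (σ′ : Fin a → Ty c) →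
  (∀ i → σ (ρ i) ≡ σ′ i) → ∀ A → subst σ (rename ρ A) ≡ subst σ′ A
subst-rename σ ρ σ′ h ⊤′      = refl
subst-rename σ ρ σ′ h (var i) = h i
subst-rename σ ρ σ′ h (A ⇒ B) = cong₂ _⇒_ (subst-rename σ ρ σ′ h A) (subst-rename σ ρ σ′ h B)
subst-rename σ ρ σ′ h (A ∧ B) = cong₂ _∧_ (subst-rename σ ρ σ′ h A) (subst-rename σ ρ σ′ h B)
subst-rename σ ρ σ′ h (∀′ A)  = cong ∀′ (subst-rename (exts σ) (ext ρ) (exts σ′) h′ A)
  where
  h′ : ∀ i → exts σ (ext ρ i) ≡ exts σ′ i
  h′ zero    = refl
  h′ (suc i) = cong weaken (h i)

rename-subst : ∀ {a b c} (ρ : Fin b → Fin c) (σ : Fin a → Ty b) (σ′ : Fin a → Ty c) →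
  (∀ i → rename ρ (σ i) ≡ σ′ i) → ∀ A → rename ρ (subst σ A) ≡ subst σ′ A
rename-subst ρ σ σ′ h ⊤′      = refl
rename-subst ρ σ σ′ h (var i) = h i
rename-subst ρ σ σ′ h (A ⇒ B) = cong₂ _⇒_ (rename-subst ρ σ σ′ h A) (rename-subst ρ σ σ′ h B)
rename-subst ρ σ σ′ h (A ∧ B) = cong₂ _∧_ (rename-subst ρ σ σ′ h A) (rename-subst ρ σ σ′ h B)
rename-subst ρ σ σ′ h (∀′ A)  = cong ∀′ (rename-subst (ext ρ) (exts σ) (exts σ′) h′ A)
  where
  h′ : ∀ i → rename (ext ρ) (exts σ i) ≡ exts σ′ i
  h′ zero    = refl
  h′ (suc i) = trans (rename-weaken ρ (σ i)) (cong weaken (h i))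

subst-weaken : ∀ {m n} (σ : Fin m → Ty n) A → subst (exts σ) (weaken A) ≡ weaken (subst σ A)
subst-weaken σ A =
  trans (subst-rename (exts σ) suc (λ i → weaken (σ i)) (λ _ → refl) A)
        (sym (rename-subst suc σ (λ i → weaken (σ i)) (λ _ → refl) A))

subst-cong : ∀ {a b} {σ σ′ : Fin a → Ty b} → (∀ i → σ i ≡ σ′ i) → ∀ A → subst σ A ≡ subst σ′ A
subst-cong h ⊤′      = refl
subst-cong h (var i) = h i
subst-cong h (A ⇒ B) = cong₂ _⇒_ (subst-cong h A) (subst-cong h B)
subst-cong h (A ∧ B) = cong₂ _∧_ (subst-cong h A) (subst-cong h B)
subst-cong {σ = σ} {σ′} h (∀′ A) = cong ∀′ (subst-cong h′ A)
  where
  h′ : ∀ i → exts σ i ≡ exts σ′ i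
  h′ zero    = refl
  h′ (suc i) = cong weaken (h i)

subst-var≡rename : ∀ {a b} (σ : Fin a → Ty b) (ρ : Fin a → Fin b) →
  (∀ i → σ i ≡ var (ρ i)) → ∀ A → subst σ A ≡ rename ρ A
subst-var≡rename σ ρ h ⊤′      = refl
subst-var≡rename σ ρ h (var i) = h i
subst-var≡rename σ ρ h (A ⇒ B) = cong₂ _⇒_ (subst-var≡rename σ ρ h A) (subst-var≡rename σ ρ h B)
subst-var≡rename σ ρ h (A ∧ B) = cong₂ _∧_ (subst-var≡rename σ ρ h A) (subst-var≡rename σ ρ h B)
subst-var≡rename σ ρ h (∀′ A)  = cong ∀′ (subst-var≡rename (exts σ) (ext ρ) h′ A)
  where
  h′ : ∀ i → exts σ i ≡ var (ext ρ i)
  h′ zero    = refl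
  h′ (suc i) = cong weaken (h i)

BoundRenaming : ∀ {m n} → Ctx m → Ctx n → (Fin m → Fin n) → Set
BoundRenaming Θ₁ Θ₂ ρ = ∀ {X U} → Θ₁ ∋ X <: U → Θ₂ ∋ ρ X <: rename ρ U

BoundRenaming-ext : ∀ {m n} {Θ₁ : Ctx m} {Θ₂ : Ctx n} {ρ} {U} → BoundRenaming Θ₁ Θ₂ ρ →
  BoundRenaming (Θ₁ ,<: U) (Θ₂ ,<: rename ρ U) (ext ρ)
BoundRenaming-ext {ρ = ρ} {U} f here rewrite rename-weaken ρ U = here
BoundRenaming-ext {ρ = ρ} f (there {T = V} x) rewrite rename-weaken ρ V = there (f x)

<:-rename : ∀ {m n} {Θ₁ : Ctx m} {Θ₂ : Ctx n} {ρ} → BoundRenaming Θ₁ Θ₂ ρ →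
  ∀ {A B} → Θ₁ ⊢ A <: B → Θ₂ ⊢ rename ρ A <: rename ρ B
<:-rename f (S-Var x)     = S-Var (f x)
<:-rename f S-Top         = S-Top
<:-rename f S-Refl        = S-Refl
<:-rename f (S-Trans d e) = S-Trans (<:-rename f d) (<:-rename f e)
<:-rename f (S-Arrow d e) = S-Arrow (<:-rename f d) (<:-rename f e)
<:-rename f (S-All d)     = S-All (<:-rename (BoundRenaming-ext f) d)
<:-rename f S-MeetL       = S-MeetL
<:-rename f S-MeetR       = S-MeetR
<:-rename f (S-Meet d e)  = S-Meet (<:-rename f d) (<:-rename f e)

<:-weaken : ∀ {n} {Θ : Ctx n} {U A B} → Θ ⊢ A <: B → (Θ ,<: U) ⊢ weaken A <: weaken B
<:-weaken = <:-rename there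

BoundSubstitution : ∀ {m n} → Ctx m → Ctx n → (Fin m → Ty n) → Set
BoundSubstitution Θ₁ Θ₂ σ = ∀ {X U} → Θ₁ ∋ X <: U → Θ₂ ⊢ σ X <: subst σ U

BoundSubstitution-exts : ∀ {m n} {Θ₁ : Ctx m} {Θ₂ : Ctx n} {σ} {U} →
  BoundSubstitution Θ₁ Θ₂ σ → BoundSubstitution (Θ₁ ,<: U) (Θ₂ ,<: subst σ U) (exts σ)
BoundSubstitution-exts {σ = σ} {U} f here rewrite subst-weaken σ U = S-Var here
BoundSubstitution-exts {σ = σ} f (there {T = V} x) rewrite subst-weaken σ V = <:-weaken (f x)

<:-subst : ∀ {m n} {Θ₁ : Ctx m} {Θ₂ : Ctx n} {σ} → BoundSubstitution Θ₁ Θ₂ σ →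
  ∀ {A B} → Θ₁ ⊢ A <: B → Θ₂ ⊢ subst σ A <: subst σ B
<:-subst f (S-Var x)     = f x
<:-subst f S-Top         = S-Top
<:-subst f S-Refl        = S-Refl
<:-subst f (S-Trans d e) = S-Trans (<:-subst f d) (<:-subst f e)
<:-subst f (S-Arrow d e) = S-Arrow (<:-subst f d) (<:-subst f e)
<:-subst f (S-All d)     = S-All (<:-subst (BoundSubstitution-exts f) d)
<:-subst f S-MeetL       = S-MeetL
<:-subst f S-MeetR       = S-MeetR
<:-subst f (S-Meet d e)  = S-Meet (<:-subst f d) (<:-subst f e)

-- The substitution of substTop is local to its where block and cannot be named, hence this copy.
meetBound : ∀ {n} → Ty n → Fin (suc n) → Ty (suc n)
meetBound S zero    = var zero ∧ weaken S
meetBound S (suc i) = var (suc i)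

substMeetBound≡subst-meetBound : ∀ {n} (S : Ty n) T → substMeetBound S T ≡ subst (meetBound S) T
substMeetBound≡subst-meetBound S T = subst-cong (λ { zero → refl ; (suc i) → refl }) T

subst-meetBound-weaken : ∀ {n} (S : Ty n) A → subst (meetBound S) (weaken A) ≡ weaken A
subst-meetBound-weaken S A =
  trans (subst-rename (meetBound S) suc (λ i → var (suc i)) (λ _ → refl) A)
        (subst-var≡rename (λ i → var (suc i)) suc (λ _ → refl) A)

meetBound-BoundSubstitution : ∀ {n} (Θ : Ctx n) (S : Ty n) →
  BoundSubstitution (Θ ,<: S) (Θ ,<: ⊤′) (meetBound S)
meetBound-BoundSubstitution Θ S here rewrite subst-meetBound-weaken S S = S-MeetR
meetBound-BoundSubstitution Θ S (there {T = U} x)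
  rewrite subst-meetBound-weaken S U = S-Var (there x)

mainTheorem15 : ∀ {n} (Θ : Ctx n) (S : Ty n) (T T′ : Ty (suc n)) →
    (Θ ,<: S) ⊢ T <: T′ →
    Θ ⊢ ∀′ (substMeetBound S T) <: ∀′ (substMeetBound S T′)
mainTheorem15 Θ S T T′ d
  rewrite substMeetBound≡subst-meetBound S T | substMeetBound≡subst-meetBound S T′ =
  S-All (<:-subst (meetBound-BoundSubstitution Θ S) d)
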